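{- The following axioms are valid according to Yalcin's semantics: \textbf{A1} $(\varphi\Rightarrow \pi)\leftrightarrow \Box(\varphi\rightarrow \pi)$ for $\pi$ a nonmodal formula; \textbf{A2} $(\varphi\Rightarrow (\alpha\wedge\beta))\leftrightarrow ((\varphi\Rightarrow\alpha)\wedge(\varphi\Rightarrow\beta))$; \textbf{A3} $(\varphi\Rightarrow (\alpha\vee \Box\beta))\leftrightarrow ((\varphi\Rightarrow \alpha)\vee (\varphi\Rightarrow\beta))$; \textbf{A4} $(\varphi\Rightarrow (\alpha\vee \Diamond \beta))\leftrightarrow ((\varphi\Rightarrow \alpha)\vee \neg (\varphi\Rightarrow\neg\beta))$.
   Context: The language $\mathcal{L}(\Rightarrow)$ is given by $\varphi::= p\mid \neg\varphi\mid (\varphi\wedge\varphi)\mid \Box\varphi \mid (\varphi\Rightarrow\varphi)$, with $\Diamond\varphi:=\neg\Box\neg\varphi$; a formula is nonmodal if it contains neither $\Box$ nor $\Rightarrow$. Models are $\mathcal{M}=\langle W,V\rangle$, and formulas are evaluated at a world $w$ relative to an information state $X\subseteq W$ (Yalcin's semantics): $\mathcal{M},w,X\vDash p$ iff $w\in V(p)$; Boolean clauses as usual; $\mathcal{M},w,X\vDash\Box\varphi$ iff $\mathcal{M},v,X\vDash\varphi$ for all $v\in X$; $\mathcal{M},w,X\vDash\varphi\Rightarrow\psi$ iff $\mathcal{M},w,[\![\varphi]\!]^{\mathcal{M},X}\vDash\Box\psi$, where $[\![\varphi]\!]^{\mathcal{M},X}=\{v\in X\mid \mathcal{M},v,X\vDash\varphi\}$.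 Valid means true at every world relative to every information state in every model. -}

module Defs where

open import Level using (0ℓ)
open import Data.Nat using (ℕ)
open import Data.Product using (_×_; Σ)
open import Data.Sum using (_⊎_)
open import Data.Empty using (⊥)
open import Relation.Nullary using (¬_)
open import Relation.Unary using (Pred; _∩_; _∈_)

data Form : Set where
  atom : ℕ → Form
  ¬'_  : Form → Form
  _∧'_ : Form → Form → Form
  □_   : Form → Form
  _⇒_  : Form → Form → Form

infixr 6 _∧'_
infixr 4 _⇒_

_∨'_ : Form → Form → Form
φ ∨' ψ = ¬' ((¬' φ) ∧' (¬' ψ))

_→'_ : Form → Form → Form
φ →' ψ = ¬' (φ ∧' (¬' ψ))

_↔'_ : Form → Form → Form
φ ↔' ψ = (φ →' ψ) ∧' (ψ →' φ)

◇_ : Form → Form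
◇ φ = ¬' (□ (¬' φ))

data Nonmodal : Form → Set where
  nm-atom : ∀ n → Nonmodal (atom n)
  nm-neg  : ∀ {φ} → Nonmodal φ → Nonmodal (¬' φ)
  nm-and  : ∀ {φ ψ} → Nonmodal φ → Nonmodal ψ → Nonmodal (φ ∧' ψ)

record Model : Set₁ where
  field
    W : Set
    V : ℕ → Pred W 0ℓ

open Model public

_,_,_⊨_ : (M : Model) → W M → Pred (W M) 0ℓ → Form → Set
M , w , X ⊨ atom n  = w ∈ V M n
M , w , X ⊨ (¬' φ)   = ¬ (M , w , X ⊨ φ)
M , w , X ⊨ (φ ∧' ψ) = (M , w , X ⊨ φ) × (M , w , X ⊨ ψ)
M , w , X ⊨ (□ φ)    = ∀ v → v ∈ X → M , v , X ⊨ φ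
-- φ ⇒ ψ holds at (w,X) iff □ψ holds at (w, ⟦φ⟧^{M,X}); the □ clause is unfolded
-- here so that termination is structural.
M , w , X ⊨ (φ ⇒ ψ)  = ∀ v → v ∈ (X ∩ (λ u → M , u , X ⊨ φ)) → M , v , (X ∩ (λ u → M , u , X ⊨ φ)) ⊨ ψ

Valid : Form → Set₁
Valid φ = ∀ (M : Model) (w : W M) (X : Pred (W M) 0ℓ) → M , w , X ⊨ φ

module Submission where

-- The key observation is that φ ⇒ ψ holds at (w, X) exactly when □ψ holds at
-- (w, ⟦φ⟧), where ⟦φ⟧ = X ∩ {u | u , X ⊨ φ}; with the semantics of Defs this
-- is true by definition.  So every axiom is an instance, at the state ⟦φ⟧, of
-- a fact about □ at an arbitrary information state Y:
--   * nonmodal formulas do not look at the information state (A1);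
--   * □(α ∧ β) ↔ □α ∧ □β (A2);
--   * □(α ∨ χ) ↔ □α ∨ χ whenever the truth of χ relative to Y does not depend
--     on the world; □β and ◇β = ¬□¬β are such formulas (A3, A4).  Excluded middle, used in the form of
-- double negation elimination, is needed for A1 and for □(α ∨ χ) → □α ∨ χ;
-- these two lemmas live in a module parametrised by it.

open import Defs
open import Level using (0ℓ)
open import Data.Product using (_×_; _,_; proj₁; proj₂)
open import Axiom.ExcludedMiddle using (ExcludedMiddle)
open import Axiom.DoubleNegationElimination
  using (DoubleNegationElimination; em⇒dne)
open import Relation.Nullary using (¬_)
open import Relation.Unary using (Pred; _∩_)

material-iff : {A B : Set} → (A → B) → (B → A) → ¬ (A × ¬ B) × ¬ (B × ¬ A)
material-iff A→B B→A = (λ { (a , ¬b) → ¬b (A→B a) })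
                     , (λ { (b , ¬a) → ¬a (B→A b) })

⟦_⟧ : Form → (M : Model) → Pred (W M) 0ℓ → Pred (W M) 0ℓ
⟦ φ ⟧ M X = X ∩ (λ u → M , u , X ⊨ φ)

nonmodal-local : ∀ {M : Model} {w : W M} {X Y : Pred (W M) 0ℓ} {π : Form} →
                 Nonmodal π → M , w , X ⊨ π → M , w , Y ⊨ π
nonmodal-local (nm-atom n)   w∈Vn    = w∈Vn
nonmodal-local (nm-neg p)    ¬π      = λ π → ¬π (nonmodal-local p π)
nonmodal-local (nm-and p q) (π , ρ) = nonmodal-local p π , nonmodal-local q ρ

□-∧ : ∀ (M : Model) (w : W M) (Y : Pred (W M) 0ℓ) (α β : Form) →
      M , w , Y ⊨ ((□ (α ∧' β)) ↔' ((□ α) ∧' (□ β)))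
□-∧ M w Y α β = material-iff
  (λ □α∧β → (λ v v∈Y → proj₁ (□α∧β v v∈Y)) , (λ v v∈Y → proj₂ (□α∧β v v∈Y)))
  (λ { (□α , □β) v v∈Y → □α v v∈Y , □β v v∈Y })

WorldIndependent : (M : Model) → Pred (W M) 0ℓ → Form → Set
WorldIndependent M Y χ = ∀ u v → M , u , Y ⊨ χ → M , v , Y ⊨ χ

□-independent : ∀ {M : Model} {Y : Pred (W M) 0ℓ} (β : Form) →
                WorldIndependent M Y (□ β)
□-independent β u v □β = □β

¬'-independent : ∀ {M : Model} {Y : Pred (W M) 0ℓ} {χ : Form} →
                 WorldIndependent M Y χ → WorldIndependent M Y (¬' χ)
¬'-independent indep u v ¬χu χv = ¬χu (indep v u χv)

module Classical (dne : DoubleNegationElimination 0ℓ) where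

  -- For nonmodal π, φ ⇒ π says that φ → π holds throughout the state: the
  -- restriction to ⟦φ⟧ is invisible to π by locality.
  ⇒-nonmodal : ∀ (M : Model) (w : W M) (X : Pred (W M) 0ℓ) (φ π : Form) →
               Nonmodal π → M , w , X ⊨ ((φ ⇒ π) ↔' (□ (φ →' π)))
  ⇒-nonmodal M w X φ π p = material-iff
    (λ φ⇒π v v∈X (φv , ¬πv) → ¬πv (nonmodal-local p (φ⇒π v (v∈X , φv))))
    (λ □φ→π v (v∈X , φv) →
       nonmodal-local p (dne (λ ¬πv → □φ→π v v∈X (φv , ¬πv))))

  -- Left to right: if χ fails at w it fails everywhere, so □(α ∨ χ) forces α
  -- at every world of Y (classically).  Right to left: a world refuting
  -- α ∨ χ refutes both □α and, by independence, χ at w.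
  □-∨-independent : ∀ (M : Model) (w : W M) (Y : Pred (W M) 0ℓ) (α χ : Form) →
                    WorldIndependent M Y χ →
                    M , w , Y ⊨ ((□ (α ∨' χ)) ↔' ((□ α) ∨' χ))
  □-∨-independent M w Y α χ indep = material-iff □[α∨χ]→□α∨χ □α∨χ→□[α∨χ]
    where
    □[α∨χ]→□α∨χ : M , w , Y ⊨ (□ (α ∨' χ)) → M , w , Y ⊨ ((□ α) ∨' χ)
    □[α∨χ]→□α∨χ □α∨χ (¬□α , ¬χw) = ¬□α λ v v∈Y →
      dne (λ ¬αv → □α∨χ v v∈Y (¬αv , λ χv → ¬χw (indep v w χv)))

    □α∨χ→□[α∨χ] : M , w , Y ⊨ ((□ α) ∨' χ) → M , w , Y ⊨ (□ (α ∨' χ))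
    □α∨χ→□[α∨χ] □α∨χw v v∈Y (¬αv , ¬χv) =
      □α∨χw ((λ □α → ¬αv (□α v v∈Y)) , (λ χw → ¬χv (indep w v χw)))

lemma2 : ExcludedMiddle 0ℓ →
    (∀ (φ π : Form) → Nonmodal π → Valid ((φ ⇒ π) ↔' (□ (φ →' π))))
    × (∀ (φ α β : Form) → Valid ((φ ⇒ (α ∧' β)) ↔' ((φ ⇒ α) ∧' (φ ⇒ β))))
    × (∀ (φ α β : Form) → Valid ((φ ⇒ (α ∨' (□ β))) ↔' ((φ ⇒ α) ∨' (φ ⇒ β))))
    × (∀ (φ α β : Form) → Valid ((φ ⇒ (α ∨' (◇ β))) ↔' ((φ ⇒ α) ∨' (¬' (φ ⇒ (¬' β))))))
lemma2 lem = A1 , A2 , A3 , A4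
  where
  open Classical (em⇒dne lem)

  A1 : ∀ (φ π : Form) → Nonmodal π → Valid ((φ ⇒ π) ↔' (□ (φ →' π)))
  A1 φ π p M w X = ⇒-nonmodal M w X φ π p

  A2 : ∀ (φ α β : Form) → Valid ((φ ⇒ (α ∧' β)) ↔' ((φ ⇒ α) ∧' (φ ⇒ β)))
  A2 φ α β M w X = □-∧ M w (⟦ φ ⟧ M X) α β

  A3 : ∀ (φ α β : Form) → Valid ((φ ⇒ (α ∨' (□ β))) ↔' ((φ ⇒ α) ∨' (φ ⇒ β)))
  A3 φ α β M w X = □-∨-independent M w (⟦ φ ⟧ M X) α (□ β) (□-independent β)

  A4 : ∀ (φ α β : Form) →
       Valid ((φ ⇒ (α ∨' (◇ β))) ↔' ((φ ⇒ α) ∨' (¬' (φ ⇒ (¬' β)))))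
  A4 φ α β M w X = □-∨-independent M w (⟦ φ ⟧ M X) α (◇ β)
                     (¬'-independent {χ = □ (¬' β)} (□-independent (¬' β)))
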